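{- Let $G$ be a finite, simple, connected graph which is randomly $k$-dimensional with $k\geq 2$. Then $\Delta(G)\geq k$, where $\Delta(G)$ is the maximum degree of $G$.
   Context: $d(x,y)$ is the distance in $G$. For an ordered set $W=\{w_1,\ldots,w_k\}\subseteq V(G)$ and $v\in V(G)$, $r(v|W)=(d(v,w_1),\ldots,d(v,w_k))$. $W$ is a resolving set if distinct vertices have distinct representations with respect to $W$. The metric dimension $\beta(G)$ is the minimum size of a resolving set; a resolving set of size $\beta(G)$ is a basis. $G$ is randomly $k$-dimensional if $\beta(G)=k$ and every $k$-subset of $V(G)$ is a basis of $G$. -}

module Defs where

open import Data.Nat using (ℕ; zero; suc; _<_; _≤_; _⊔_)
open import Data.Fin using (Fin)
open import Data.Bool using (Bool; true; false; T; if_then_else_)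
open import Data.List using (List; map; foldr; allFin)
open import Data.Nat.ListAction using (sum)
open import Data.Product using (Σ; ∃; _×_; _,_)
open import Relation.Binary.PropositionalEquality using (_≡_)
open import Relation.Nullary using (¬_)
open import Function.Definitions using (Injective)
open import Level using (0ℓ)

-- A finite simple graph on the vertex set Fin n
-- (loopless, undirected, no multi-edges: adjacency is a Boolean relation).
record Graph (n : ℕ) : Set where
  field
    adj    : Fin n → Fin n → Bool
    symm   : ∀ u v → adj u v ≡ adj v u
    irrefl : ∀ v → adj v v ≡ false
open Graph public

module _ {n : ℕ} (G : Graph n) where

  data Walk : Fin n → Fin n → ℕ → Set where
    here : ∀ {x} → Walk x x 0
    step : ∀ {x y z m} → T (adj G x y) → Walk y z m → Walk x z (suc m)

  Dist : Fin n → Fin n → ℕ → Set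
  Dist x y m = Walk x y m × (∀ m' → Walk x y m' → m ≤ m')

  Connected : Set
  Connected = ∀ x y → ∃ λ m → Walk x y m

  Resolving : {k : ℕ} → (Fin k → Fin n) → Set
  Resolving {k} w = ∀ u v →
    (∀ i m → (Dist u (w i) m → Dist v (w i) m) × (Dist v (w i) m → Dist u (w i) m)) →
    u ≡ v

  MetricDim : ℕ → Set
  MetricDim k =
    (Σ (Fin k → Fin n) λ w → Injective _≡_ _≡_ w × Resolving w) ×
    (∀ j → j < k → (w : Fin j → Fin n) → Injective _≡_ _≡_ w → ¬ Resolving w)

  RandomlyDim : ℕ → Set
  RandomlyDim k = MetricDim k ×
    ((w : Fin k → Fin n) → Injective _≡_ _≡_ w → Resolving w)

  degree : Fin n → ℕ
  degree v = sum (map (λ u → if adj G v u then 1 else 0) (allFin n))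

  maxDegree : ℕ
  maxDegree = foldr (λ v acc → degree v ⊔ acc) 0 (allFin n)

-- Let β = k + 1 and suppose Δ(G) ≤ k. Pick v of maximum degree and a set W of k
-- vertices with v ∉ W and N(v) ⊆ W. We show that W resolves G, contradicting β(G) = k + 1.
-- Two vertices p, q ≠ v that agree on W also agree on v, since every walk into v
-- enters through N(v) ⊆ W; so they agree on the basis W ∪ {v}. A vertex q ≠ v agreeing
-- with v on W satisfies N(v) ⊆ N(q), hence N(v) = N(q) by maximality of deg v: q is a
-- twin of v outside W. Twins have equal distances to all other vertices, so no basis
-- avoids both of them; hence V = W ∪ {v, q}. Replacing in W a neighbour x of v by v then
-- gives a resolving k-set, as x and q are at distance 1 and 2 from v.

module Submission where

open import Defs
open import Data.Nat using (ℕ; zero; suc; _≤_; _<_; _≤?_; z≤n; s≤s; s≤s⁻¹; _⊔_)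
open import Data.Nat.Properties
  using (≤-refl; ≤-trans; ≤-antisym; <⇒≤; ≮⇒≥; <⇒≱; ≰⇒>; +-mono-≤; +-mono-≤-<; ⊔-sel; ⊔-identityʳ; ≤-reflexive;
         m≤m⊔n; m≤n⇒m≤o⊔n; anyUpTo?)
open import Data.Nat.Induction using (<-rec)
open import Data.Nat.ListAction using (sum)
open import Data.Fin using (Fin; zero; suc; punchIn; inject≤; _≟_)
open import Data.Fin.Properties using (punchIn-injective; punchInᵢ≢i; injective⇒≤; inject≤-injective; inject≤-trans; any?)
open import Data.Bool using (Bool; true; false; T; if_then_else_)
open import Data.List using (List; []; _∷_; _++_; length; map; foldr; filter; lookup; allFin)
open import Data.List.Membership.Propositional using (_∈_)
open import Data.List.Membership.Propositional.Properties
  using (∈-allFin; ∈-lookup; ∈-filter⁺; ∈-filter⁻; ∈-++⁺ˡ; ∈-++⁺ʳ; ∈-++⁻)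
open import Data.List.Relation.Unary.Any using (here; there; index)
open import Data.List.Relation.Unary.Any.Properties using (lookup-index)
import Data.List.Relation.Unary.All as All
open import Data.List.Relation.Unary.AllPairs using (_∷_)
open import Data.List.Relation.Unary.Unique.Propositional using (Unique)
import Data.List.Relation.Unary.Unique.Propositional.Properties as Unique
open import Data.Vec.Functional as V using (Vector; updateAt)
open import Data.Vec.Functional.Properties using (updateAt-updates; updateAt-minimal)
open import Data.Product using (Σ; ∃; _×_; _,_; proj₁; proj₂)
open import Data.Sum using (_⊎_; inj₁; inj₂)
open import Data.Empty using (⊥; ⊥-elim)
open import Data.Unit using (tt)
open import Function using (_∘_; const)
open import Function.Definitions using (Injective)
open import Induction.WellFounded using (WfRec)
open import Level using (0ℓ)
open import Relation.Binary.PropositionalEquality using (_≡_; _≢_; refl; sym; trans; cong; subst; module ≡-Reasoning)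
open import Relation.Nullary using (¬_; Dec; yes; no; ¬?)
open import Relation.Nullary.Decidable using (_×-dec_; decidable-stable)
open import Relation.Nullary.Decidable.Core using (T?)
open import Relation.Unary using (Pred; Decidable; _⊆_; _≐_)

open ≡-Reasoning

module _ {A : Set} where

  -- degree G v unfolds to countTrue (adj G v) (allFin n).
  countTrue : (A → Bool) → List A → ℕ
  countTrue f xs = sum (map (λ x → if f x then 1 else 0) xs)

  indicator-mono : ∀ {a b} → (T a → T b) → (if a then 1 else 0) ≤ (if b then 1 else 0)
  indicator-mono {false} _ = z≤n
  indicator-mono {true} {true} _ = ≤-refl
  indicator-mono {true} {false} a⇒b = ⊥-elim (a⇒b tt)

  countTrue-mono : ∀ {f g : A → Bool} → (∀ {x} → T (f x) → T (g x)) →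
                   ∀ xs → countTrue f xs ≤ countTrue g xs
  countTrue-mono f⇒g [] = z≤n
  countTrue-mono f⇒g (x ∷ xs) = +-mono-≤ (indicator-mono f⇒g) (countTrue-mono f⇒g xs)

  countTrue-mono-< : ∀ {f g : A → Bool} → (∀ {x} → T (f x) → T (g x)) →
                     ∀ {x xs} → x ∈ xs → T (g x) → ¬ T (f x) → countTrue f xs < countTrue g xs
  countTrue-mono-< {f} {g} f⇒g {x} {_ ∷ xs} (here refl) gx ¬fx with f x | g x
  ... | false | true = s≤s (countTrue-mono f⇒g xs)
  ... | false | false = ⊥-elim gx
  ... | true | _ = ⊥-elim (¬fx tt)
  countTrue-mono-< f⇒g {xs = y ∷ _} (there x∈xs) gx ¬fx =
    +-mono-≤-< (indicator-mono f⇒g) (countTrue-mono-< f⇒g x∈xs gx ¬fx)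

  countTrue-≥⇒⊇ : ∀ {f g : A → Bool} → (∀ {x} → T (f x) → T (g x)) →
                  ∀ {xs} → countTrue g xs ≤ countTrue f xs → ∀ {x} → x ∈ xs → T (g x) → T (f x)
  countTrue-≥⇒⊇ {f} f⇒g g≤f {x} x∈xs gx =
    decidable-stable (T? (f x)) (λ ¬fx → <⇒≱ (countTrue-mono-< f⇒g x∈xs gx ¬fx) g≤f)

  length-filter-T : ∀ (f : A → Bool) xs → length (filter (T? ∘ f) xs) ≡ countTrue f xs
  length-filter-T f [] = refl
  length-filter-T f (x ∷ xs) with f x
  ... | true = cong suc (length-filter-T f xs)
  ... | false = length-filter-T f xs

  lookup-injective : ∀ {xs : List A} → Unique xs → Injective _≡_ _≡_ (lookup xs)
  lookup-injective (_ ∷ _) {zero} {zero} _ = refl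
  lookup-injective (x∉xs ∷ _) {zero} {suc j} eq = ⊥-elim (All.lookup x∉xs (∈-lookup j) eq)
  lookup-injective (x∉xs ∷ _) {suc i} {zero} eq = ⊥-elim (All.lookup x∉xs (∈-lookup i) (sym eq))
  lookup-injective (_ ∷ unique) {suc i} {suc j} eq = cong suc (lookup-injective unique eq)

  lookup-++-inject≤ : ∀ (ys zs : List A) (i : Fin (length ys)) .(p : length ys ≤ length (ys ++ zs)) →
                      lookup (ys ++ zs) (inject≤ i p) ≡ lookup ys i
  lookup-++-inject≤ (y ∷ ys) zs zero _ = refl
  lookup-++-inject≤ (y ∷ ys) zs (suc i) p = lookup-++-inject≤ ys zs i (s≤s⁻¹ p)

  injection-≤-length : ∀ {m xs} (g : Fin m → A) → Injective _≡_ _≡_ g → (∀ i → g i ∈ xs) → m ≤ length xs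
  injection-≤-length {xs = xs} g g-inj g∈xs = injective⇒≤ (λ {i} {j} eq → g-inj (begin
      g i                        ≡⟨ lookup-index (g∈xs i) ⟩
      lookup xs (index (g∈xs i)) ≡⟨ cong (lookup xs) eq ⟩
      lookup xs (index (g∈xs j)) ≡⟨ lookup-index (g∈xs j) ⟨
      g j                        ∎))

  _∈ᵥ_ : ∀ {k} → A → Vector A k → Set
  x ∈ᵥ w = ∃ λ i → w i ≡ x

  _∉ᵥ_ : ∀ {k} → A → Vector A k → Set
  x ∉ᵥ w = ¬ x ∈ᵥ w

  enumerate : ∀ {k} (xs : List A) → k ≤ length xs → Vector A k
  enumerate xs k≤ i = lookup xs (inject≤ i k≤)

  enumerate-injective : ∀ {k xs} (k≤ : k ≤ length xs) → Unique xs → Injective _≡_ _≡_ (enumerate xs k≤)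
  enumerate-injective k≤ unique eq = inject≤-injective k≤ k≤ _ _ (lookup-injective unique eq)

  enumerate-∈ : ∀ {k xs} (k≤ : k ≤ length xs) i → enumerate xs k≤ i ∈ xs
  enumerate-∈ k≤ i = ∈-lookup _

  enumerate-++-covers : ∀ {k} (ys zs : List A) (k≤ : k ≤ length (ys ++ zs)) → length ys ≤ k →
                        ∀ {y} → y ∈ ys → y ∈ᵥ enumerate (ys ++ zs) k≤
  enumerate-++-covers ys zs k≤ ys≤k y∈ys = inject≤ (index y∈ys) ys≤k , (begin
      lookup (ys ++ zs) (inject≤ (inject≤ (index y∈ys) ys≤k) k≤) ≡⟨ cong (lookup (ys ++ zs)) (inject≤-trans _ ys≤k k≤) ⟩
      lookup (ys ++ zs) (inject≤ (index y∈ys) (≤-trans ys≤k k≤)) ≡⟨ lookup-++-inject≤ ys zs _ _ ⟩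
      lookup ys (index y∈ys)                                      ≡⟨ lookup-index y∈ys ⟨
      _                                                           ∎)

  ∷-injective : ∀ {k x} {w : Vector A k} → x ∉ᵥ w → Injective _≡_ _≡_ w → Injective _≡_ _≡_ (x V.∷ w)
  ∷-injective x∉w w-inj {zero} {zero} _ = refl
  ∷-injective x∉w w-inj {zero} {suc j} eq = ⊥-elim (x∉w (j , sym eq))
  ∷-injective x∉w w-inj {suc i} {zero} eq = ⊥-elim (x∉w (i , eq))
  ∷-injective x∉w w-inj {suc i} {suc j} eq = cong suc (w-inj eq)

  updateAt-const-injective : ∀ {k x} {w : Vector A k} (i : Fin k) → x ∉ᵥ w → Injective _≡_ _≡_ w →
                             Injective _≡_ _≡_ (updateAt w i (const x))
  updateAt-const-injective {x = x} {w} i x∉w w-inj {a} {b} eq with a ≟ i | b ≟ i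
  ... | yes refl | yes refl = refl
  ... | yes refl | no b≢i = ⊥-elim (x∉w (b , (begin
        w b                      ≡⟨ updateAt-minimal b i w b≢i ⟨
        updateAt w i (const x) b ≡⟨ eq ⟨
        updateAt w i (const x) i ≡⟨ updateAt-updates i w ⟩
        x                        ∎)))
  ... | no a≢i | yes refl = ⊥-elim (x∉w (a , (begin
        w a                      ≡⟨ updateAt-minimal a i w a≢i ⟨
        updateAt w i (const x) a ≡⟨ eq ⟩
        updateAt w i (const x) i ≡⟨ updateAt-updates i w ⟩
        x                        ∎)))
  ... | no a≢i | no b≢i = w-inj (begin
        w a                      ≡⟨ updateAt-minimal a i w a≢i ⟨
        updateAt w i (const x) a ≡⟨ eq ⟩
        updateAt w i (const x) b ≡⟨ updateAt-minimal b i w b≢i ⟩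
        w b                      ∎)

module _ {A : Set} (h : A → ℕ) where

  ≤-foldr-⊔ : ∀ {x xs} → x ∈ xs → h x ≤ foldr (λ y acc → h y ⊔ acc) 0 xs
  ≤-foldr-⊔ {xs = y ∷ _} (here refl) = m≤m⊔n (h y) _
  ≤-foldr-⊔ {xs = y ∷ _} (there x∈xs) = m≤n⇒m≤o⊔n (h y) (≤-foldr-⊔ x∈xs)

  foldr-⊔-attained : ∀ {x xs} → x ∈ xs → ∃ λ y → foldr (λ y acc → h y ⊔ acc) 0 xs ≡ h y
  foldr-⊔-attained {xs = y ∷ []} _ = y , ⊔-identityʳ (h y)
  foldr-⊔-attained {xs = y ∷ z ∷ zs} _ with foldr-⊔-attained {xs = z ∷ zs} (here refl)
  ... | u , max≡hu with ⊔-sel (h y) (foldr (λ y acc → h y ⊔ acc) 0 (z ∷ zs))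
  ...   | inj₁ ⊔≡hy = y , ⊔≡hy
  ...   | inj₂ ⊔≡max = u , trans ⊔≡max max≡hu

injection-avoiding-covering : ∀ {n k} (f : Fin n → Bool) (v : Fin n) → ¬ T (f v) →
  countTrue f (allFin n) ≤ k → suc k ≤ n →
  Σ (Vector (Fin n) k) λ w → Injective _≡_ _≡_ w × v ∉ᵥ w × (∀ {u} → T (f u) → u ∈ᵥ w)
injection-avoiding-covering {suc n} {k} f v ¬fv f≤k k<n =
  enumerate xs k≤xs , enumerate-injective k≤xs unique , v∉w ,
  λ fu → enumerate-++-covers ys zs k≤xs ys≤k (∈-filter⁺ marked? (∈-allFin _) fu)
  where
  marked? : Decidable (T ∘ f)
  marked? = T? ∘ f

  unmarked? : Decidable (λ u → ¬ T (f u) × u ≢ v)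
  unmarked? u = ¬? (T? (f u)) ×-dec ¬? (u ≟ v)

  ys zs xs : List (Fin (suc n))
  ys = filter marked? (allFin _)
  zs = filter unmarked? (allFin _)
  xs = ys ++ zs

  unique : Unique xs
  unique = Unique.++⁺ (Unique.filter⁺ marked? (Unique.allFin⁺ _))
                      (Unique.filter⁺ unmarked? (Unique.allFin⁺ _))
    λ (u∈ys , u∈zs) → proj₁ (proj₂ (∈-filter⁻ unmarked? u∈zs)) (proj₂ (∈-filter⁻ marked? u∈ys))

  ys≤k : length ys ≤ k
  ys≤k = subst (_≤ k) (sym (length-filter-T f (allFin _))) f≤k

  others∈xs : ∀ i → punchIn v i ∈ xs
  others∈xs i with T? (f (punchIn v i))
  ... | yes fu = ∈-++⁺ˡ (∈-filter⁺ marked? (∈-allFin _) fu)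
  ... | no ¬fu = ∈-++⁺ʳ ys (∈-filter⁺ unmarked? (∈-allFin _) (¬fu , punchInᵢ≢i v i))

  k≤xs : k ≤ length xs
  k≤xs = ≤-trans (s≤s⁻¹ k<n) (injection-≤-length (punchIn v) (punchIn-injective v _ _) others∈xs)

  v∉w : v ∉ᵥ enumerate xs k≤xs
  v∉w (i , wi≡v) with ∈-++⁻ ys (enumerate-∈ k≤xs i)
  ... | inj₁ ∈ys = ¬fv (subst (T ∘ f) wi≡v (proj₂ (∈-filter⁻ marked? ∈ys)))
  ... | inj₂ ∈zs = proj₂ (proj₂ (∈-filter⁻ unmarked? ∈zs)) wi≡v

module GraphProperties {n : ℕ} (G : Graph n) where

  infix 4 _∼_
  _∼_ : Fin n → Fin n → Set
  x ∼ y = T (adj G x y)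

  N : Fin n → Pred (Fin n) 0ℓ
  N x = x ∼_

  ∼-irrefl : ∀ {x} → ¬ x ∼ x
  ∼-irrefl {x} x∼x = subst T (irrefl G x) x∼x

  ∼-sym : ∀ {x y} → x ∼ y → y ∼ x
  ∼-sym {x} {y} = subst T (symm G x y)

  walk-0 : ∀ {x y} → Walk G x y 0 → x ≡ y
  walk-0 here = refl

  walk-1 : ∀ {x y} → Walk G x y 1 → x ∼ y
  walk-1 (step x∼y here) = x∼y

  walk-≢⇒neighbour : ∀ {x y m} → Walk G x y m → x ≢ y → ∃ (x ∼_)
  walk-≢⇒neighbour here x≢x = ⊥-elim (x≢x refl)
  walk-≢⇒neighbour (step x∼z _) _ = _ , x∼z

  snoc : ∀ {x y z m} → Walk G x y m → y ∼ z → Walk G x z (suc m)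
  snoc here y∼z = step y∼z here
  snoc (step x∼x′ w) y∼z = step x∼x′ (snoc w y∼z)

  unsnoc : ∀ {x z m} → Walk G x z (suc m) → ∃ λ y → Walk G x y m × y ∼ z
  unsnoc (step x∼z here) = _ , here , x∼z
  unsnoc (step x∼x′ w@(step _ _)) with unsnoc w
  ... | y , w′ , y∼z = y , step x∼x′ w′ , y∼z

  walk? : ∀ x y m → Dec (Walk G x y m)
  walk? x y zero with x ≟ y
  ... | yes refl = yes here
  ... | no x≢y = no (x≢y ∘ walk-0)
  walk? x y (suc m) with any? (λ z → T? (adj G x z) ×-dec walk? z y m)
  ... | yes (z , x∼z , w) = yes (step x∼z w)
  ... | no ¬w = no λ { (step x∼z w) → ¬w (_ , x∼z , w) }

  walk⇒dist : ∀ {x y m} → Walk G x y m → ∃ λ d → d ≤ m × Dist G x y d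
  walk⇒dist {x} {y} {m} = <-rec ShortestBelow shorten m
    where
    ShortestBelow : ℕ → Set
    ShortestBelow m = Walk G x y m → ∃ λ d → d ≤ m × Dist G x y d

    shorten : ∀ m → WfRec _<_ ShortestBelow m → ShortestBelow m
    shorten m rec w with anyUpTo? (walk? x y) m
    ... | yes (m′ , m′<m , w′) with rec m′<m w′
    ...   | d , d≤m′ , dist = d , ≤-trans d≤m′ (<⇒≤ m′<m) , dist
    shorten m rec w | no none = m , ≤-refl , w , λ m′ w′ → ≮⇒≥ λ m′<m → none (m′ , m′<m , w′)

  dist-0 : ∀ x → Dist G x x 0
  dist-0 x = here , λ _ _ → z≤n

  dist-1 : ∀ {x y} → x ∼ y → Dist G x y 1
  dist-1 x∼y = step x∼y here , λ { zero w → ⊥-elim (∼-irrefl (subst (_ ∼_) (sym (walk-0 w)) x∼y))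
                                 ; (suc _) _ → s≤s z≤n }

  -- The hypothesis of Resolving G w is, definitionally, ∀ i → SameDist p q (w i).
  SameDist : Fin n → Fin n → Fin n → Set
  SameDist p q t = ∀ m → (Dist G p t m → Dist G q t m) × (Dist G q t m → Dist G p t m)

  sameDist-sym : ∀ {p q t} → SameDist p q t → SameDist q p t
  sameDist-sym p≈q m = proj₂ (p≈q m) , proj₁ (p≈q m)

  sameDist-self : ∀ {p q} → SameDist p q p → p ≡ q
  sameDist-self p≈q = sym (walk-0 (proj₁ (proj₁ (p≈q 0) (dist-0 _))))

  NoFarther : (t q p : Fin n) → Set
  NoFarther t q p = ∀ m → Walk G p t m → ∃ λ m′ → m′ ≤ m × Walk G q t m′

  noFarther⇒dist : ∀ {t p q m} → NoFarther t q p → NoFarther t p q → Dist G p t m → Dist G q t m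
  noFarther⇒dist {m = m} q≼p p≼q (w , minimal) with q≼p m w
  ... | m′ , m′≤m , w′ = subst (Walk G _ _) (≤-antisym m′≤m (minimal′ m′ w′)) w′ , minimal′
    where
    minimal′ : ∀ m″ → Walk G _ _ m″ → m ≤ m″
    minimal′ m″ w″ with p≼q m″ w″
    ... | m‴ , m‴≤m″ , w‴ = ≤-trans (minimal m‴ w‴) m‴≤m″

  noFarther⇒sameDist : ∀ {t p q} → NoFarther t q p → NoFarther t p q → SameDist p q t
  noFarther⇒sameDist q≼p p≼q m = noFarther⇒dist q≼p p≼q , noFarther⇒dist p≼q q≼p

  noFarther-⊆ : ∀ {s s′ t} → N s ⊆ N s′ → t ≢ s → NoFarther t s′ s
  noFarther-⊆ N⊆ t≢s zero here = ⊥-elim (t≢s refl)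
  noFarther-⊆ N⊆ t≢s (suc m) (step s∼x w) = suc m , ≤-refl , step (N⊆ s∼x) w

  sameDist-twins : ∀ {s s′ t} → N s ≐ N s′ → t ≢ s → t ≢ s′ → SameDist s s′ t
  sameDist-twins (N⊆ , N⊇) t≢s t≢s′ = noFarther⇒sameDist (noFarther-⊆ N⊆ t≢s) (noFarther-⊆ N⊇ t≢s′)

  noFarther-via-neighbours : ∀ {p q t} → p ≢ t → (∀ {y} → t ∼ y → SameDist p q y) → NoFarther t q p
  noFarther-via-neighbours p≢t _ zero w = ⊥-elim (p≢t (walk-0 w))
  noFarther-via-neighbours p≢t p≈q (suc m) w with unsnoc w
  ... | y , w′ , y∼t with walk⇒dist w′
  ...   | d , d≤m , dist = suc d , s≤s d≤m , snoc (proj₁ (proj₁ (p≈q (∼-sym y∼t) d) dist)) y∼t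

  sameDist-via-neighbours : ∀ {p q t} → p ≢ t → q ≢ t → (∀ {y} → t ∼ y → SameDist p q y) → SameDist p q t
  sameDist-via-neighbours p≢t q≢t p≈q = noFarther⇒sameDist
    (noFarther-via-neighbours p≢t p≈q) (noFarther-via-neighbours q≢t (sameDist-sym ∘ p≈q))

  degree≤maxDegree : ∀ v → degree G v ≤ maxDegree G
  degree≤maxDegree v = ≤-foldr-⊔ (degree G) (∈-allFin v)

  maxDegree-attained : Fin n → ∃ λ v → maxDegree G ≡ degree G v
  maxDegree-attained v = foldr-⊔-attained (degree G) (∈-allFin v)

module RandomlyDimensional {n k : ℕ} (G : Graph n) (randomly : RandomlyDim G (suc k)) where

  open GraphProperties G

  β-set-resolving : (w : Vector (Fin n) (suc k)) → Injective _≡_ _≡_ w → Resolving G w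
  β-set-resolving = proj₂ randomly

  smaller-set-¬resolving : (w : Vector (Fin n) k) → Injective _≡_ _≡_ w → ¬ Resolving G w
  smaller-set-¬resolving = proj₂ (proj₁ randomly) k ≤-refl

  twins-cover : ∀ {v b} → v ≢ b → N v ≐ N b → (w : Vector (Fin n) k) → Injective _≡_ _≡_ w →
                v ∉ᵥ w → b ∉ᵥ w → ∀ x → x ∈ᵥ w ⊎ x ≡ v ⊎ x ≡ b
  twins-cover {v} {b} v≢b twins w w-inj v∉w b∉w x with any? (λ i → w i ≟ x) | x ≟ v | x ≟ b
  ... | yes x∈w | _ | _ = inj₁ x∈w
  ... | no _ | yes x≡v | _ = inj₂ (inj₁ x≡v)
  ... | no _ | no _ | yes x≡b = inj₂ (inj₂ x≡b)
  ... | no x∉w | no x≢v | no x≢b = ⊥-elim (v≢b (β-set-resolving (x V.∷ w) (∷-injective x∉w w-inj) v b v≈b))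
    where
    v≈b : ∀ i → SameDist v b ((x V.∷ w) i)
    v≈b zero = sameDist-twins twins x≢v x≢b
    v≈b (suc i) = sameDist-twins twins (λ wi≡v → v∉w (i , wi≡v)) (λ wi≡b → b∉w (i , wi≡b))

  twins-outside⇒neighbours-outside : ∀ {v b} → v ≢ b → N v ≐ N b → (w : Vector (Fin n) k) → Injective _≡_ _≡_ w →
                                     v ∉ᵥ w → b ∉ᵥ w → ∀ {x} → v ∼ x → x ∉ᵥ w
  twins-outside⇒neighbours-outside {v} {b} v≢b twins w w-inj v∉w b∉w v∼x (i₀ , refl) =
    smaller-set-¬resolving w′ (updateAt-const-injective i₀ v∉w w-inj) w′-resolving
    where
    w′ : Vector (Fin n) k
    w′ = updateAt w i₀ (const v)

    outside : ∀ p → p ∉ᵥ w′ → p ≡ w i₀ ⊎ p ≡ b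
    outside p p∉w′ with twins-cover v≢b twins w w-inj v∉w b∉w p
    ... | inj₂ (inj₂ p≡b) = inj₂ p≡b
    ... | inj₂ (inj₁ refl) = ⊥-elim (p∉w′ (i₀ , updateAt-updates i₀ w))
    ... | inj₁ (j , wj≡p) with j ≟ i₀
    ...   | yes refl = inj₁ (sym wj≡p)
    ...   | no j≢i₀ = ⊥-elim (p∉w′ (j , trans (updateAt-minimal j i₀ w j≢i₀) wj≡p))

    at-v : ∀ {p q} → SameDist p q (w′ i₀) → SameDist p q v
    at-v = subst (SameDist _ _) (updateAt-updates i₀ w)

    separated : ∀ {p q} → p ≡ w i₀ → q ≡ b → ¬ SameDist p q v
    separated refl refl x≈b = ∼-irrefl (proj₂ twins (walk-1 (proj₁ (proj₁ (x≈b 1) (dist-1 (∼-sym v∼x))))))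

    w′-resolving : Resolving G w′
    w′-resolving p q p≈q with any? (λ i → w′ i ≟ p) | any? (λ i → w′ i ≟ q)
    ... | yes (i , refl) | _ = sameDist-self (p≈q i)
    ... | no _ | yes (i , refl) = sym (sameDist-self (sameDist-sym (p≈q i)))
    ... | no p∉w′ | no q∉w′ with outside p p∉w′ | outside q q∉w′
    ...   | inj₁ p≡x | inj₁ q≡x = trans p≡x (sym q≡x)
    ...   | inj₂ p≡b | inj₂ q≡b = trans p≡b (sym q≡b)
    ...   | inj₁ p≡x | inj₂ q≡b = ⊥-elim (separated p≡x q≡b (at-v (p≈q i₀)))
    ...   | inj₂ p≡b | inj₁ q≡x = ⊥-elim (separated q≡x p≡b (sameDist-sym (at-v (p≈q i₀))))

  module _ (connected : Connected G) {v : Fin n} (v-max : ∀ u → degree G u ≤ degree G v)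
           (w : Vector (Fin n) k) (w-inj : Injective _≡_ _≡_ w) (v∉w : v ∉ᵥ w) (N⊆w : N v ⊆ (_∈ᵥ w)) where

    separates-max-degree-vertex : ∀ {q} → q ≢ v → ¬ (∀ i → SameDist v q (w i))
    separates-max-degree-vertex {q} q≢v v≈q with walk-≢⇒neighbour (proj₂ (connected v q)) (q≢v ∘ sym)
    ... | _ , v∼x = twins-outside⇒neighbours-outside (q≢v ∘ sym) twins w w-inj v∉w q∉w v∼x (N⊆w v∼x)
      where
      N⊆ : N v ⊆ N q
      N⊆ v∼y with N⊆w v∼y
      ... | i , refl = walk-1 (proj₁ (proj₁ (v≈q i 1) (dist-1 v∼y)))

      twins : N v ≐ N q
      twins = N⊆ , λ {y} → countTrue-≥⇒⊇ {f = adj G v} {g = adj G q} N⊆ (v-max q) (∈-allFin y)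

      q∉w : q ∉ᵥ w
      q∉w (i , refl) = q≢v (sameDist-self (sameDist-sym (v≈q i)))

    max-degree-neighbourhood-resolving : Resolving G w
    max-degree-neighbourhood-resolving p q p≈q with p ≟ v | q ≟ v
    ... | yes refl | yes refl = refl
    ... | yes refl | no q≢v = ⊥-elim (separates-max-degree-vertex q≢v p≈q)
    ... | no p≢v | yes refl = ⊥-elim (separates-max-degree-vertex p≢v (sameDist-sym ∘ p≈q))
    ... | no p≢v | no q≢v = β-set-resolving (v V.∷ w) (∷-injective v∉w w-inj) p q v∷w-agree
      where
      N-agree : ∀ {y} → v ∼ y → SameDist p q y
      N-agree v∼y with N⊆w v∼y
      ... | i , refl = p≈q i

      v∷w-agree : ∀ i → SameDist p q ((v V.∷ w) i)
      v∷w-agree zero = sameDist-via-neighbours p≢v q≢v N-agree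
      v∷w-agree (suc i) = p≈q i

  maxDegree≰k : Connected G → ¬ maxDegree G ≤ k
  maxDegree≰k connected Δ≤k =
    let basis , basis-inj , _ = proj₁ (proj₁ randomly)
        v , Δ≡dv = maxDegree-attained (basis zero)
        v-max u = ≤-trans (degree≤maxDegree u) (≤-reflexive Δ≡dv)
        dv≤k = ≤-trans (≤-reflexive (sym Δ≡dv)) Δ≤k
        w , w-inj , v∉w , N⊆w = injection-avoiding-covering (adj G v) v ∼-irrefl dv≤k (injective⇒≤ basis-inj)
    in smaller-set-¬resolving w w-inj (max-degree-neighbourhood-resolving connected v-max w w-inj v∉w N⊆w)

  β≤maxDegree : Connected G → suc k ≤ maxDegree G
  β≤maxDegree connected = decidable-stable (suc k ≤? maxDegree G) (maxDegree≰k connected ∘ s≤s⁻¹ ∘ ≰⇒>)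

mainTheorem7 : (n : ℕ) (G : Graph n) (k : ℕ) →
    Connected G → RandomlyDim G k → 2 ≤ k → k ≤ maxDegree G
mainTheorem7 n G zero _ _ _ = z≤n
mainTheorem7 n G (suc k) connected randomly _ = RandomlyDimensional.β≤maxDegree G randomly connected
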